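{- Let $k\ge 2$ and let $\mathcal{H}$ be a $k$-uniform threshold hypergraph given by a binary sequence, with short sequence $C(a_1,\dots,a_r)_k$ and adjacency matrix $A(\mathcal{H})=(a_{i,j})$. Let $j\in\{1,\dots,r\}$ with $a_j\ge 2$ and let $s=a_1+\dots+a_{j-1}+1$ (the index of the first vertex of the $j$-th block). Then $-a_{s,s+1}$ is an eigenvalue of $A(\mathcal{H})$ with multiplicity at least $a_j-1$.
   Context: Let $k\ge 2$ and $n$ be positive integers and let $(b_1,\dots,b_n)_k$ be a binary sequence ($b_i\in\{0,1\}$) with $b_1=\dots=b_{k-1}=0$. The $k$-uniform threshold hypergraph $\mathcal{H}=(V,E)$ given by this sequence has vertex set $V=\{v_1,\dots,v_n\}$, and a set $e$ is an edge if and only if $e$ is a $k$-element subset of $V$ and $b_j=1$, where $j=\max\{i: v_i\in e\}$. The adjacency matrix $A(\mathcal{H})=(a_{i,j})$ is the $n\times n$ symmetric matrix with $a_{i,j}=|\{e\in E: v_i,v_j\in e\}|$ for $i\ne j$ and $a_{i,i}=0$. Short sequence: if $b_k=0$, $(a_1,\dots,a_r)$ are the lengths of the successive maximal runs of equal consecutive entries of $(b_1,\dots,b_n)$; if $b_k=1$, $a_1$ is the total length of the first two runs (the initial $k-1$ zeros together with the following run of ones) and $a_2,\dots,a_r$ are the lengths of the subsequent maximal runs. The $t$-th block consists of the vertices $v_i$ with $a_1+\dots+a_{t-1}<i\le a_1+\dots+a_t$. -}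

module Defs where

open import Data.Bool using (Bool; true; false; if_then_else_; _∧_)
open import Data.Nat using (ℕ; zero; suc; _+_; _*_; _∸_; _≡ᵇ_)
open import Data.Fin using (Fin; zero; suc; _≟_)
open import Data.Maybe using (Maybe; just; nothing)
open import Data.List using (List; []; _∷_; _++_; map)
open import Data.Vec using (Vec; []; _∷_; lookup; toList)
open import Data.Integer using (ℤ; +_; -_) renaming (_+_ to _+ℤ_; _*_ to _*ℤ_)
open import Relation.Nullary.Decidable using (⌊_⌋)
open import Relation.Binary.PropositionalEquality using (_≡_)

-- Subsets of {v_1,...,v_n} as Bool-vectors (index i : Fin n stands for v_{i+1}).
Subset : ℕ → Set
Subset n = Vec Bool n

allSubsets : (n : ℕ) → List (Subset n)
allSubsets zero = [] ∷ []
allSubsets (suc n) = map (false ∷_) (allSubsets n) ++ map (true ∷_) (allSubsets n)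

card : ∀ {n} → Subset n → ℕ
card [] = 0
card (true ∷ p) = suc (card p)
card (false ∷ p) = card p

maxElem : ∀ {n} → Subset n → Maybe (Fin n)
maxElem [] = nothing
maxElem (false ∷ p) with maxElem p
... | just x = just (suc x)
... | nothing = nothing
maxElem (true ∷ p) with maxElem p
... | just x = just (suc x)
... | nothing = just zero

countB : ∀ {A : Set} → (A → Bool) → List A → ℕ
countB f [] = 0
countB f (x ∷ xs) = if f x then suc (countB f xs) else countB f xs

isEdge : ∀ {n} → (k : ℕ) → Vec Bool n → Subset n → Bool
isEdge k b e with maxElem e
... | just m = (card e ≡ᵇ k) ∧ lookup b m
... | nothing = false

adj : ∀ {n} → (k : ℕ) → Vec Bool n → Fin n → Fin n → ℕ
adj {n} k b i j =
  if ⌊ i ≟ j ⌋ then 0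
  else countB (λ e → isEdge k b e ∧ lookup e i ∧ lookup e j) (allSubsets n)

eqBool : Bool → Bool → Bool
eqBool true true = true
eqBool false false = true
eqBool _ _ = false

runsFrom : Bool → ℕ → List Bool → List ℕ
runsFrom c m [] = m ∷ []
runsFrom c m (y ∷ ys) = if eqBool y c then runsFrom c (suc m) ys else m ∷ runsFrom y 1 ys

runs : List Bool → List ℕ
runs [] = []
runs (x ∷ xs) = runsFrom x 1 xs

mergeFirstTwo : List ℕ → List ℕ
mergeFirstTwo (x ∷ y ∷ zs) = (x + y) ∷ zs
mergeFirstTwo l = l

entry : List Bool → ℕ → Bool
entry [] _ = false
entry (x ∷ xs) zero = x
entry (x ∷ xs) (suc m) = entry xs m

shortSeq : ∀ {n} → (k : ℕ) → Vec Bool n → List ℕ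
shortSeq k b =
  if entry (toList b) (k ∸ 1) then mergeFirstTwo (runs (toList b)) else runs (toList b)

sumFin : ∀ {n} → (Fin n → ℤ) → ℤ
sumFin {zero} f = + 0
sumFin {suc n} f = f zero +ℤ sumFin (λ i → f (suc i))

IsEigenvectorEq : ∀ {n} → (Fin n → Fin n → ℤ) → ℤ → (Fin n → ℤ) → Set
IsEigenvectorEq M λ' x = ∀ i → sumFin (λ l → M i l *ℤ x l) ≡ λ' *ℤ x i

-- linear independence of m vectors (integer coefficients; equivalent to over ℚ / ℝ)
LinIndep : ∀ {n m} → (Fin m → Fin n → ℤ) → Set
LinIndep {n} vs = ∀ (c : _ → ℤ) → (∀ i → sumFin (λ l → c l *ℤ vs l i) ≡ + 0) → ∀ l → c l ≡ + 0

-- λ is an eigenvalue of M with (geometric) multiplicity at least m: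
-- the eigenspace contains m linearly independent vectors.
-- (For the symmetric matrix A(H), geometric = algebraic multiplicity.)
EigenvalueMultAtLeast : ∀ {n} → (Fin n → Fin n → ℤ) → ℤ → ℕ → Set
EigenvalueMultAtLeast {n} M λ' m =
  Data.Product.Σ (Fin m → Fin n → ℤ) (λ vs → (∀ l → IsEigenvectorEq M λ' (vs l)) Data.Product.× LinIndep vs)
  where import Data.Product

-- Two consecutive vertices of a block can be exchanged by an automorphism of ℋ: either they carry the
-- same entry of b, or (in a first block merged with the following run of ones) both lie among
-- v_1, …, v_k, where the only edge whose largest vertex is one of them is {v_1, …, v_k}, containing both.
-- Exchangeable vertices are twins (their rows of A agree outside the pair), so every vertex y of the
-- j-th block is a twin of its first vertex v_s, at the common weight a_{s,s+1}. For twins x, y of a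
-- symmetric matrix with zero diagonal, e_y − e_x is an eigenvector for −a_{x,y}; the a_j − 1 vectors
-- e_y − e_{v_s} are independent, since e_y − e_{v_s} is the only one with a nonzero y-coordinate.

module Submission where

module TwinEigenvectors where

  open import Defs using (sumFin; IsEigenvectorEq; EigenvalueMultAtLeast)
  import Data.Nat as ℕ
  open import Data.Fin using (Fin; zero; suc; _≟_)
  open import Data.Integer using (ℤ; +_; -_; _+_; _-_; _*_)
  open import Data.Integer.Properties using (*-identityʳ; *-zeroʳ; +-identityʳ; +-identityˡ)
  open import Data.Integer.Tactic.RingSolver using (solve-∀)
  open import Data.Product using (_,_)
  open import Function using (_∘_)
  open import Function.Definitions using (Injective)
  open import Relation.Nullary using (yes; no; contradiction)
  open import Relation.Binary.PropositionalEquality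
  open ≡-Reasoning

  Twins : ∀ {A : Set} {n} → (Fin n → Fin n → A) → Fin n → Fin n → Set
  Twins M x y = ∀ i → i ≢ x → i ≢ y → M i x ≡ M i y

  twins-trans : ∀ {A : Set} {n} {M : Fin n → Fin n → A} → (∀ i j → M i j ≡ M j i) →
    ∀ {x y z} → x ≢ y → y ≢ z → x ≢ z → Twins M x y → Twins M y z → Twins M x z
  twins-trans {M = M} sym-M {x} {y} {z} x≢y y≢z x≢z xy yz i i≢x i≢z with i ≟ y
  ... | yes refl = begin
    M y x ≡⟨ sym-M y x ⟩
    M x y ≡⟨ yz x x≢y x≢z ⟩
    M x z ≡⟨ sym-M x z ⟩
    M z x ≡⟨ xy z (≢-sym x≢z) (≢-sym y≢z) ⟩
    M z y ≡⟨ sym-M z y ⟩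
    M y z ∎
  ... | no i≢y = trans (xy i i≢x i≢y) (yz i i≢y i≢z)

  δ : ∀ {n} → Fin n → Fin n → ℤ
  δ zero    zero    = + 1
  δ zero    (suc _) = + 0
  δ (suc _) zero    = + 0
  δ (suc i) (suc j) = δ i j

  δ-refl : ∀ {n} (i : Fin n) → δ i i ≡ + 1
  δ-refl zero    = refl
  δ-refl (suc i) = δ-refl i

  δ-≢ : ∀ {n} {i j : Fin n} → i ≢ j → δ i j ≡ + 0
  δ-≢ {i = zero}  {zero}  i≢j = contradiction refl i≢j
  δ-≢ {i = zero}  {suc _} _   = refl
  δ-≢ {i = suc _} {zero}  _   = refl
  δ-≢ {i = suc i} {suc j} i≢j = δ-≢ (i≢j ∘ cong suc)

  δ-sym : ∀ {n} (i j : Fin n) → δ i j ≡ δ j i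
  δ-sym zero    zero    = refl
  δ-sym zero    (suc _) = refl
  δ-sym (suc _) zero    = refl
  δ-sym (suc i) (suc j) = δ-sym i j

  δ-∘-injective : ∀ {m n} {f : Fin m → Fin n} → Injective _≡_ _≡_ f → ∀ i j → δ (f i) (f j) ≡ δ i j
  δ-∘-injective {f = f} f-inj i j with i ≟ j
  ... | yes refl = trans (δ-refl (f i)) (sym (δ-refl i))
  ... | no i≢j   = trans (δ-≢ (i≢j ∘ f-inj)) (sym (δ-≢ i≢j))

  sumFin-cong : ∀ {n} {f g : Fin n → ℤ} → (∀ t → f t ≡ g t) → sumFin f ≡ sumFin g
  sumFin-cong {ℕ.zero}  f≗g = refl
  sumFin-cong {ℕ.suc n} f≗g = cong₂ _+_ (f≗g zero) (sumFin-cong (f≗g ∘ suc))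

  sumFin-zero : ∀ n → sumFin {n} (λ _ → + 0) ≡ + 0
  sumFin-zero ℕ.zero    = refl
  sumFin-zero (ℕ.suc n) = trans (+-identityˡ _) (sumFin-zero n)

  sumFin-minus : ∀ {n} (f g : Fin n → ℤ) → sumFin (λ t → f t - g t) ≡ sumFin f - sumFin g
  sumFin-minus {ℕ.zero}  f g = refl
  sumFin-minus {ℕ.suc n} f g = begin
    (f zero - g zero) + sumFin (λ t → f (suc t) - g (suc t))
      ≡⟨ cong (_+_ (f zero - g zero)) (sumFin-minus (f ∘ suc) (g ∘ suc)) ⟩
    (f zero - g zero) + (sumFin (f ∘ suc) - sumFin (g ∘ suc))
      ≡⟨ interchange (f zero) (g zero) (sumFin (f ∘ suc)) (sumFin (g ∘ suc)) ⟩
    (f zero + sumFin (f ∘ suc)) - (g zero + sumFin (g ∘ suc)) ∎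
    where
    interchange : ∀ a b c d → (a - b) + (c - d) ≡ (a + c) - (b + d)
    interchange = solve-∀

  sumFin-δ : ∀ {n} (f : Fin n → ℤ) (x : Fin n) → sumFin (λ t → f t * δ t x) ≡ f x
  sumFin-δ {ℕ.suc n} f zero = begin
    f zero * + 1 + sumFin (λ t → f (suc t) * + 0)
      ≡⟨ cong₂ _+_ (*-identityʳ (f zero)) (sumFin-cong (*-zeroʳ ∘ f ∘ suc)) ⟩
    f zero + sumFin {n} (λ _ → + 0)
      ≡⟨ cong (_+_ (f zero)) (sumFin-zero n) ⟩
    f zero + + 0
      ≡⟨ +-identityʳ (f zero) ⟩
    f zero ∎
  sumFin-δ {ℕ.suc n} f (suc x) = begin
    f zero * + 0 + sumFin (λ t → f (suc t) * δ t x)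
      ≡⟨ cong₂ _+_ (*-zeroʳ (f zero)) (sumFin-δ (f ∘ suc) x) ⟩
    + 0 + f (suc x)
      ≡⟨ +-identityˡ (f (suc x)) ⟩
    f (suc x) ∎

  sumFin-δ-difference : ∀ {n} (f : Fin n → ℤ) (x y : Fin n) →
    sumFin (λ t → f t * (δ t y - δ t x)) ≡ f y - f x
  sumFin-δ-difference f x y = begin
    sumFin (λ t → f t * (δ t y - δ t x))
      ≡⟨ sumFin-cong (λ t → distrib (f t) (δ t y) (δ t x)) ⟩
    sumFin (λ t → f t * δ t y - f t * δ t x)
      ≡⟨ sumFin-minus (λ t → f t * δ t y) (λ t → f t * δ t x) ⟩
    sumFin (λ t → f t * δ t y) - sumFin (λ t → f t * δ t x)
      ≡⟨ cong₂ _-_ (sumFin-δ f y) (sumFin-δ f x) ⟩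
    f y - f x ∎
    where
    distrib : ∀ a b c → a * (b - c) ≡ a * b - a * c
    distrib = solve-∀

  twin-eigenvector : ∀ {n} {M : Fin n → Fin n → ℤ} →
    (∀ i j → M i j ≡ M j i) → (∀ i → M i i ≡ + 0) →
    ∀ {x y} → x ≢ y → Twins M x y → IsEigenvectorEq M (- M x y) (λ t → δ t y - δ t x)
  twin-eigenvector {M = M} sym-M diag {x} {y} x≢y twins i =
    trans (sumFin-δ-difference (M i) x y) (coordinate i)
    where
    coordinate : ∀ i → M i y - M i x ≡ - M x y * (δ i y - δ i x)
    coordinate i with i ≟ x | i ≟ y
    ... | yes refl | _ rewrite δ-≢ x≢y | δ-refl x | diag x = at-x (M x y)
      where
      at-x : ∀ c → c - + 0 ≡ - c * (+ 0 - + 1)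
      at-x = solve-∀
    ... | no _ | yes refl rewrite δ-≢ (≢-sym x≢y) | δ-refl y | diag y | sym-M y x = at-y (M x y)
      where
      at-y : ∀ c → + 0 - c ≡ - c * (+ 1 - + 0)
      at-y = solve-∀
    ... | no i≢x | no i≢y rewrite δ-≢ i≢x | δ-≢ i≢y | twins i i≢x i≢y = elsewhere (M x y) (M i y)
      where
      elsewhere : ∀ c d → d - d ≡ - c * (+ 0 - + 0)
      elsewhere = solve-∀

  twin-class-eigenvalue : ∀ {n m} {M : Fin n → Fin n → ℤ} →
    (∀ i j → M i j ≡ M j i) → (∀ i → M i i ≡ + 0) →
    (x : Fin n) (ys : Fin m → Fin n) → Injective _≡_ _≡_ ys → (∀ l → x ≢ ys l) →
    (∀ l → Twins M x (ys l)) → (c : ℤ) → (∀ l → M x (ys l) ≡ c) →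
    EigenvalueMultAtLeast M (- c) m
  twin-class-eigenvalue {n} {m} {M} sym-M diag x ys ys-inj x≢ys twins c weight =
    vs , eigen , independent
    where
    vs : Fin m → Fin n → ℤ
    vs l t = δ t (ys l) - δ t x

    eigen : ∀ l → IsEigenvectorEq M (- c) (vs l)
    eigen l = subst (λ c → IsEigenvectorEq M (- c) (vs l)) (weight l)
      (twin-eigenvector sym-M diag (x≢ys l) (twins l))

    coordinate : ∀ l L → δ l L ≡ vs l (ys L)
    coordinate l L = begin
      δ l L                       ≡⟨ δ-sym l L ⟩
      δ L l                       ≡⟨ δ-∘-injective ys-inj L l ⟨
      δ (ys L) (ys l)             ≡⟨ +-identityʳ _ ⟨
      δ (ys L) (ys l) - + 0       ≡⟨ cong (_-_ (δ (ys L) (ys l))) (δ-≢ (≢-sym (x≢ys L))) ⟨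
      δ (ys L) (ys l) - δ (ys L) x ∎

    independent : ∀ a → (∀ i → sumFin (λ l → a l * vs l i) ≡ + 0) → ∀ L → a L ≡ + 0
    independent a a·vs≡0 L = begin
      a L                                ≡⟨ sumFin-δ a L ⟨
      sumFin (λ l → a l * δ l L)         ≡⟨ sumFin-cong (λ l → cong (a l *_) (coordinate l L)) ⟩
      sumFin (λ l → a l * vs l (ys L))   ≡⟨ a·vs≡0 (ys L) ⟩
      + 0                                ∎

module TwinRuns where

  open TwinEigenvectors using (Twins; twins-trans; twin-class-eigenvalue)
  open import Defs using (EigenvalueMultAtLeast)
  open import Data.Nat using (ℕ; zero; suc; _+_; _∸_; _≤_; _<_; s≤s; z<s)
  open import Data.Nat.Properties
    using (+-suc; +-comm; +-identityʳ; +-cancelˡ-≡; +-monoʳ-<; m<m+n; n<1+n; <-trans; <-≤-trans; suc-injective)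
  open import Data.Fin using (Fin; toℕ; fromℕ<)
  open import Data.Fin.Properties using (toℕ-fromℕ<; toℕ-injective; toℕ<n; <⇒≢)
  open import Data.Integer using (ℤ; +_; -_)
  open import Data.Product using (_×_; _,_; proj₁; proj₂)
  open import Relation.Binary.PropositionalEquality

  TwinRun : ∀ {A : Set} {n} → (Fin n → Fin n → A) → ℕ → ℕ → Set
  TwinRun {n = n} M P a =
    ∀ {d} → suc d < a → ∀ {x y : Fin n} → toℕ x ≡ P + d → toℕ y ≡ suc (toℕ x) → Twins M x y

  run-twins-of-first : ∀ {A : Set} {n} {M : Fin n → Fin n → A} → (∀ i j → M i j ≡ M j i) →
    ∀ {a} (p q : Fin n) → toℕ q ≡ suc (toℕ p) → TwinRun M (toℕ p) a →
    ∀ d → suc d < a → ∀ {y} → toℕ y ≡ toℕ p + suc d → Twins M p y × M p y ≡ M p q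
  run-twins-of-first {M = M} sym-M p q q≡ run zero 1<a {y} y≡ =
    run 1<a (sym (+-identityʳ (toℕ p))) y≡suc-p , cong (M p) (toℕ-injective (trans y≡suc-p (sym q≡)))
    where
    y≡suc-p : toℕ y ≡ suc (toℕ p)
    y≡suc-p = trans y≡ (+-comm (toℕ p) 1)
  run-twins-of-first {n = n} {M} sym-M p q q≡ run (suc d) d+2<a {y} y≡ =
    twins-trans sym-M (<⇒≢ p<x) (<⇒≢ x<y) (<⇒≢ p<y) p~x x~y ,
    trans (sym (x~y p (<⇒≢ p<x) (<⇒≢ p<y))) Mpx≡Mpq
    where
    P : ℕ
    P = toℕ p
    P+1+d<P+2+d : P + suc d < P + suc (suc d)
    P+1+d<P+2+d = +-monoʳ-< P (n<1+n (suc d))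
    x : Fin n
    x = fromℕ< (<-trans P+1+d<P+2+d (subst (_< n) y≡ (toℕ<n y)))
    x≡ : toℕ x ≡ P + suc d
    x≡ = toℕ-fromℕ< _
    p<x : P < toℕ x
    p<x = subst (P <_) (sym x≡) (m<m+n P z<s)
    x<y : toℕ x < toℕ y
    x<y = subst₂ _<_ (sym x≡) (sym y≡) P+1+d<P+2+d
    p<y : P < toℕ y
    p<y = <-trans p<x x<y
    x~y : Twins M x y
    x~y = run d+2<a x≡ (trans y≡ (trans (+-suc P (suc d)) (cong suc (sym x≡))))
    previous : Twins M p x × M p x ≡ M p q
    previous = run-twins-of-first sym-M p q q≡ run d (<-trans (n<1+n (suc d)) d+2<a) x≡
    p~x : Twins M p x
    p~x = proj₁ previous
    Mpx≡Mpq : M p x ≡ M p q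
    Mpx≡Mpq = proj₂ previous

  run-eigenvalue : ∀ {n} {M : Fin n → Fin n → ℤ} →
    (∀ i j → M i j ≡ M j i) → (∀ i → M i i ≡ + 0) →
    (p q : Fin n) (a : ℕ) → toℕ p + a ≤ n → toℕ q ≡ suc (toℕ p) → TwinRun M (toℕ p) a →
    EigenvalueMultAtLeast M (- M p q) (a ∸ 1)
  run-eigenvalue {n} {M} sym-M diag p q a p+a≤n q≡ run =
    twin-class-eigenvalue sym-M diag p ys ys-injective p≢ys
      (λ l → proj₁ (first l)) (M p q) (λ l → proj₂ (first l))
    where
    inside : ∀ {a l} → l < a ∸ 1 → suc l < a
    inside {suc a} l<a = s≤s l<a
    ys : Fin (a ∸ 1) → Fin n
    ys l = fromℕ< (<-≤-trans (+-monoʳ-< (toℕ p) (inside (toℕ<n l))) p+a≤n)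
    ys≡ : ∀ l → toℕ (ys l) ≡ toℕ p + suc (toℕ l)
    ys≡ l = toℕ-fromℕ< _
    ys-injective : ∀ {l l'} → ys l ≡ ys l' → l ≡ l'
    ys-injective {l} {l'} eq = toℕ-injective (suc-injective
      (+-cancelˡ-≡ (toℕ p) _ _ (trans (sym (ys≡ l)) (trans (cong toℕ eq) (ys≡ l')))))
    p≢ys : ∀ l → p ≢ ys l
    p≢ys l = <⇒≢ (subst (toℕ p <_) (sym (ys≡ l)) (m<m+n (toℕ p) z<s))
    first : ∀ l → Twins M p (ys l) × M p (ys l) ≡ M p q
    first l = run-twins-of-first sym-M p q q≡ run (toℕ l) (inside (toℕ<n l)) (ys≡ l)

module AdjacentTransposition where

  open import Defs
  open TwinEigenvectors using (Twins)
  open import Data.Bool using (Bool; true; false; if_then_else_; _∧_; _∨_; T)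
  open import Data.Bool.Properties using (∧-comm; ∧-zeroʳ)
  open import Data.Nat using (ℕ; zero; suc; _+_; _≤_; _<_; _≡ᵇ_; s≤s⁻¹)
  open import Data.Nat.Properties
    using (≡ᵇ⇒≡; ≤-refl; ≤-trans; n≤1+n; suc-injective; +-commutativeSemigroup)
  open import Algebra.Properties.CommutativeSemigroup +-commutativeSemigroup using (interchange)
  open import Data.Fin using (Fin; zero; suc; toℕ; _≟_)
  open import Data.Fin.Properties using (toℕ-injective)
  open import Data.Maybe using (just; nothing; is-just; maybe′)
  open import Data.List using ([]; _∷_; _++_; map)
  open import Data.Vec using (Vec; []; _∷_; lookup; toList)
  open import Data.Sum as Sum using (_⊎_; [_,_])
  open import Data.Empty using (⊥-elim)
  open import Data.Unit using (tt)
  open import Function using (_∘_; id)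
  open import Relation.Nullary using (¬_; yes; no; contradiction)
  open import Relation.Binary.PropositionalEquality
  open ≡-Reasoning

  swap : ∀ {n} → ℕ → Subset n → Subset n
  swap zero    (x ∷ y ∷ e) = y ∷ x ∷ e
  swap zero    e           = e
  swap (suc u) []          = []
  swap (suc u) (x ∷ e)     = x ∷ swap u e

  count : ∀ {n} → (Subset n → Bool) → ℕ
  count {n} f = countB f (allSubsets n)

  countB-++ : ∀ {A : Set} (f : A → Bool) xs ys → countB f (xs ++ ys) ≡ countB f xs + countB f ys
  countB-++ f []       ys = refl
  countB-++ f (x ∷ xs) ys with f x
  ... | true  = cong suc (countB-++ f xs ys)
  ... | false = countB-++ f xs ys

  countB-map : ∀ {A B : Set} (f : B → Bool) (g : A → B) xs → countB f (map g xs) ≡ countB (f ∘ g) xs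
  countB-map f g []       = refl
  countB-map f g (x ∷ xs) with f (g x)
  ... | true  = cong suc (countB-map f g xs)
  ... | false = countB-map f g xs

  countB-cong : ∀ {A : Set} {f g : A → Bool} → (∀ x → f x ≡ g x) → ∀ xs → countB f xs ≡ countB g xs
  countB-cong f≗g []       = refl
  countB-cong {g = g} f≗g (x ∷ xs) rewrite f≗g x with g x
  ... | true  = cong suc (countB-cong f≗g xs)
  ... | false = countB-cong f≗g xs

  count-cong : ∀ {n} {f g : Subset n → Bool} → (∀ e → f e ≡ g e) → count f ≡ count g
  count-cong {n} f≗g = countB-cong f≗g (allSubsets n)

  count-split : ∀ {n} (f : Subset (suc n) → Bool) →
    count f ≡ count (f ∘ (false ∷_)) + count (f ∘ (true ∷_))
  count-split {n} f = begin
    countB f (map (false ∷_) (allSubsets n) ++ map (true ∷_) (allSubsets n))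
      ≡⟨ countB-++ f (map (false ∷_) (allSubsets n)) _ ⟩
    countB f (map (false ∷_) (allSubsets n)) + countB f (map (true ∷_) (allSubsets n))
      ≡⟨ cong₂ _+_ (countB-map f (false ∷_) (allSubsets n)) (countB-map f (true ∷_) (allSubsets n)) ⟩
    count (f ∘ (false ∷_)) + count (f ∘ (true ∷_)) ∎

  count-swap : ∀ {n} u (f : Subset n → Bool) → count (f ∘ swap u) ≡ count f
  count-swap {zero}        zero    f = refl
  count-swap {suc zero}    zero    f = refl
  count-swap {suc (suc n)} zero    f = begin
    count (f ∘ swap zero)
      ≡⟨ count-split (f ∘ swap zero) ⟩
    count (f ∘ swap zero ∘ (false ∷_)) + count (f ∘ swap zero ∘ (true ∷_))
      ≡⟨ cong₂ _+_ (count-split (f ∘ swap zero ∘ (false ∷_)))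
                   (count-split (f ∘ swap zero ∘ (true ∷_))) ⟩
    (count (g false false) + count (g true false)) + (count (g false true) + count (g true true))
      ≡⟨ interchange (count (g false false)) _ _ _ ⟩
    (count (g false false) + count (g false true)) + (count (g true false) + count (g true true))
      ≡⟨ cong₂ _+_ (count-split (f ∘ (false ∷_))) (count-split (f ∘ (true ∷_))) ⟨
    count (f ∘ (false ∷_)) + count (f ∘ (true ∷_))
      ≡⟨ count-split f ⟨
    count f ∎
    where
    g : Bool → Bool → Subset n → Bool
    g x y e = f (x ∷ y ∷ e)
  count-swap {zero}  (suc u) f = refl
  count-swap {suc n} (suc u) f = begin
    count (f ∘ swap (suc u))
      ≡⟨ count-split (f ∘ swap (suc u)) ⟩
    count (f ∘ (false ∷_) ∘ swap u) + count (f ∘ (true ∷_) ∘ swap u)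
      ≡⟨ cong₂ _+_ (count-swap u (f ∘ (false ∷_))) (count-swap u (f ∘ (true ∷_))) ⟩
    count (f ∘ (false ∷_)) + count (f ∘ (true ∷_))
      ≡⟨ count-split f ⟨
    count f ∎

  nonEmpty : ∀ {n} → Subset n → Bool
  nonEmpty []      = false
  nonEmpty (x ∷ e) = x ∨ nonEmpty e

  atMax : ∀ {n} → Vec Bool n → Subset n → Bool
  atMax []      []      = false
  atMax (y ∷ b) (x ∷ e) = if nonEmpty e then atMax b e else x ∧ y

  nonEmpty-maxElem : ∀ {n} (e : Subset n) → nonEmpty e ≡ is-just (maxElem e)
  nonEmpty-maxElem []          = refl
  nonEmpty-maxElem (false ∷ e) with maxElem e | nonEmpty-maxElem e
  ... | just _  | ih = ih
  ... | nothing | ih = ih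
  nonEmpty-maxElem (true ∷ e) with maxElem e
  ... | just _  = refl
  ... | nothing = refl

  atMax-maxElem : ∀ {n} (b : Vec Bool n) e → atMax b e ≡ maybe′ (lookup b) false (maxElem e)
  atMax-maxElem []      []          = refl
  atMax-maxElem (y ∷ b) (false ∷ e) rewrite nonEmpty-maxElem e with maxElem e | atMax-maxElem b e
  ... | just _  | ih = ih
  ... | nothing | _  = refl
  atMax-maxElem (y ∷ b) (true ∷ e) rewrite nonEmpty-maxElem e with maxElem e | atMax-maxElem b e
  ... | just _  | ih = ih
  ... | nothing | _  = refl

  isEdge-atMax : ∀ {n} k (b : Vec Bool n) e → isEdge k b e ≡ (card e ≡ᵇ k) ∧ atMax b e
  isEdge-atMax k b e rewrite atMax-maxElem b e with maxElem e
  ... | just _  = refl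
  ... | nothing = sym (∧-zeroʳ _)

  card-swap : ∀ {n} u (e : Subset n) → card (swap u e) ≡ card e
  card-swap zero    []                 = refl
  card-swap zero    (_ ∷ [])           = refl
  card-swap zero    (true ∷ true ∷ _)   = refl
  card-swap zero    (true ∷ false ∷ _)  = refl
  card-swap zero    (false ∷ true ∷ _)  = refl
  card-swap zero    (false ∷ false ∷ _) = refl
  card-swap (suc u) []                 = refl
  card-swap (suc u) (true ∷ e)         = cong suc (card-swap u e)
  card-swap (suc u) (false ∷ e)        = card-swap u e

  nonEmpty-swap : ∀ {n} u (e : Subset n) → nonEmpty (swap u e) ≡ nonEmpty e
  nonEmpty-swap zero    []                 = refl
  nonEmpty-swap zero    (_ ∷ [])           = refl
  nonEmpty-swap zero    (true ∷ true ∷ _)   = refl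
  nonEmpty-swap zero    (true ∷ false ∷ _)  = refl
  nonEmpty-swap zero    (false ∷ true ∷ _)  = refl
  nonEmpty-swap zero    (false ∷ false ∷ _) = refl
  nonEmpty-swap (suc u) []                 = refl
  nonEmpty-swap (suc u) (x ∷ e)            = cong (x ∨_) (nonEmpty-swap u e)

  card-empty : ∀ {n} (e : Subset n) → nonEmpty e ≡ false → ¬ 0 < card e
  card-empty []          _       ()
  card-empty (true ∷ e)  ()
  card-empty (false ∷ e) e-empty = card-empty e e-empty

  card-∷ : ∀ {n} x (e : Subset n) → card (x ∷ e) ≤ suc (card e)
  card-∷ true  e = ≤-refl
  card-∷ false e = n≤1+n (card e)

  -- The swap can only move the largest element of e if that element is u or u + 1, and then e ⊆ {0, …, u + 1}.
  atMax-swap : ∀ {n} u (b : Vec Bool n) e →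
    entry (toList b) u ≡ entry (toList b) (suc u) ⊎ suc u < card e → atMax b (swap u e) ≡ atMax b e
  atMax-swap zero    []           []                 _ = refl
  atMax-swap zero    (_ ∷ [])     (_ ∷ [])           _ = refl
  atMax-swap zero    (_ ∷ _ ∷ _)  (true ∷ true ∷ _)   _ = refl
  atMax-swap zero    (_ ∷ _ ∷ _)  (false ∷ false ∷ _) _ = refl
  atMax-swap zero    (y ∷ y' ∷ _) (true ∷ false ∷ e) h with nonEmpty e in e-empty
  ... | true = refl
  ... | false = [ sym , ⊥-elim ∘ card-empty e e-empty ∘ s≤s⁻¹ ] h
  atMax-swap zero    (y ∷ y' ∷ _) (false ∷ true ∷ e) h with nonEmpty e in e-empty
  ... | true = refl
  ... | false = [ id , ⊥-elim ∘ card-empty e e-empty ∘ s≤s⁻¹ ] h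
  atMax-swap (suc u) []           []                 _ = refl
  atMax-swap (suc u) (y ∷ b)      (x ∷ e)            h rewrite nonEmpty-swap u e with nonEmpty e
  ... | true  = atMax-swap u b e (Sum.map₂ (λ u+2<|x∷e| → s≤s⁻¹ (≤-trans u+2<|x∷e| (card-∷ x e))) h)
  ... | false = refl

  -- u is 0-based: the two vertices are v_{u+1} and v_{u+2}.
  Exchangeable : ∀ {n} → ℕ → Vec Bool n → ℕ → Set
  Exchangeable k b u = entry (toList b) u ≡ entry (toList b) (suc u) ⊎ suc (suc u) ≤ k

  isEdge-swap : ∀ {n} k (b : Vec Bool n) u e → Exchangeable k b u → isEdge k b (swap u e) ≡ isEdge k b e
  isEdge-swap k b u e exch = begin
    isEdge k b (swap u e)
      ≡⟨ isEdge-atMax k b (swap u e) ⟩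
    (card (swap u e) ≡ᵇ k) ∧ atMax b (swap u e)
      ≡⟨ cong (λ c → (c ≡ᵇ k) ∧ atMax b (swap u e)) (card-swap u e) ⟩
    (card e ≡ᵇ k) ∧ atMax b (swap u e)
      ≡⟨ edge-swap ⟩
    (card e ≡ᵇ k) ∧ atMax b e
      ≡⟨ isEdge-atMax k b e ⟨
    isEdge k b e ∎
    where
    edge-swap : (card e ≡ᵇ k) ∧ atMax b (swap u e) ≡ (card e ≡ᵇ k) ∧ atMax b e
    edge-swap with card e ≡ᵇ k in |e|≡ᵇk
    ... | false = refl
    ... | true  = atMax-swap u b e
      (Sum.map₂ (subst (suc u <_) (sym (≡ᵇ⇒≡ (card e) k (subst T (sym |e|≡ᵇk) tt)))) exch)

  lookup-swap-other : ∀ {n} u (e : Subset n) i → toℕ i ≢ u → toℕ i ≢ suc u →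
    lookup (swap u e) i ≡ lookup e i
  lookup-swap-other zero    (_ ∷ [])    zero          i≢0 _   = contradiction refl i≢0
  lookup-swap-other zero    (_ ∷ _ ∷ _) zero          i≢0 _   = contradiction refl i≢0
  lookup-swap-other zero    (_ ∷ _ ∷ _) (suc zero)    _   i≢1 = contradiction refl i≢1
  lookup-swap-other zero    (_ ∷ _ ∷ _) (suc (suc i)) _ _   = refl
  lookup-swap-other (suc u) (_ ∷ _)     zero          _ _   = refl
  lookup-swap-other (suc u) (_ ∷ e)     (suc i)   i≢u i≢u+1 =
    lookup-swap-other u e i (i≢u ∘ cong suc) (i≢u+1 ∘ cong suc)

  lookup-swap-next : ∀ {n} (e : Subset n) (x y : Fin n) → toℕ y ≡ suc (toℕ x) →
    lookup (swap (toℕ x) e) y ≡ lookup e x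
  lookup-swap-next (_ ∷ _ ∷ _) zero    (suc zero) _  = refl
  lookup-swap-next (_ ∷ e)     (suc x) (suc y)    eq = lookup-swap-next e x y (suc-injective eq)

  edgeThrough : ∀ {n} k (b : Vec Bool n) → Fin n → Fin n → Subset n → Bool
  edgeThrough k b i j e = isEdge k b e ∧ lookup e i ∧ lookup e j

  adj-≢ : ∀ {n} k (b : Vec Bool n) {i j} → i ≢ j → adj k b i j ≡ count (edgeThrough k b i j)
  adj-≢ k b {i} {j} i≢j with i ≟ j
  ... | yes i≡j = contradiction i≡j i≢j
  ... | no _    = refl

  adj-diagonal : ∀ {n} k (b : Vec Bool n) i → adj k b i i ≡ 0
  adj-diagonal k b i with i ≟ i
  ... | yes _   = refl
  ... | no i≢i  = contradiction refl i≢i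

  adj-sym : ∀ {n} k (b : Vec Bool n) i j → adj k b i j ≡ adj k b j i
  adj-sym k b i j with i ≟ j
  ... | yes refl = sym (adj-diagonal k b i)
  ... | no i≢j   = begin
    count (edgeThrough k b i j)  ≡⟨ count-cong (λ e → cong (isEdge k b e ∧_) (∧-comm (lookup e i) _)) ⟩
    count (edgeThrough k b j i)  ≡⟨ adj-≢ k b (≢-sym i≢j) ⟨
    adj k b j i                  ∎

  adjacent-twins : ∀ {n} k (b : Vec Bool n) {x y : Fin n} →
    Exchangeable k b (toℕ x) → toℕ y ≡ suc (toℕ x) → Twins (adj k b) x y
  adjacent-twins k b {x} {y} exch y≡ i i≢x i≢y = begin
    adj k b i x                                     ≡⟨ adj-≢ k b i≢x ⟩
    count (edgeThrough k b i x)                     ≡⟨ count-cong through-swap ⟩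
    count (edgeThrough k b i y ∘ swap (toℕ x))      ≡⟨ count-swap (toℕ x) (edgeThrough k b i y) ⟩
    count (edgeThrough k b i y)                     ≡⟨ adj-≢ k b i≢y ⟨
    adj k b i y                                     ∎
    where
    i≢x+1 : toℕ i ≢ suc (toℕ x)
    i≢x+1 i≡x+1 = i≢y (toℕ-injective (trans i≡x+1 (sym y≡)))
    through-swap : ∀ e → edgeThrough k b i x e ≡ edgeThrough k b i y (swap (toℕ x) e)
    through-swap e = sym (cong₂ _∧_ (isEdge-swap k b (toℕ x) e exch)
      (cong₂ _∧_ (lookup-swap-other (toℕ x) e i (i≢x ∘ toℕ-injective) i≢x+1)
                 (lookup-swap-next e x y y≡)))

module ShortSequenceBlocks where

  open import Defs
  open AdjacentTransposition using (Exchangeable)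
  open import Data.Bool using (Bool; true; false)
  open import Data.Nat using (ℕ; zero; suc; _+_; _∸_; _≤_; _<_; s≤s; s≤s⁻¹)
  open import Data.Nat.Properties
    using (+-assoc; +-suc; +-identityʳ; +-monoʳ-≤; +-cancelˡ-<; m≤m+n; m+[n∸m]≡n; n<1+n; <-trans; <⇒≤; ≮⇒≥; <-cmp)
  open import Data.Fin using (zero; suc; toℕ)
  open import Data.List using (List; []; _∷_; _++_; length; lookup; take; replicate)
  open import Data.Nat.ListAction using (sum)
  open import Data.Vec using (Vec; toList)
  open import Data.Vec.Properties using (length-toList)
  open import Data.Product using (_×_; _,_; proj₁; proj₂)
  open import Data.Sum using (inj₁; inj₂)
  open import Relation.Nullary using (contradiction)
  open import Relation.Binary.Definitions using (tri<; tri≈; tri>)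
  open import Relation.Binary.PropositionalEquality

  Block : (ℕ → Set) → ℕ → ℕ → Set
  Block R o a = ∀ d → suc d < a → R (o + d)

  Blocks : (ℕ → Set) → ℕ → List ℕ → Set
  Blocks R len rs = ∀ j →
    sum (take (toℕ j) rs) + lookup rs j ≤ len × Block R (sum (take (toℕ j) rs)) (lookup rs j)

  Blocks-map : ∀ {R S len rs} → (∀ u → R u → S u) → Blocks R len rs → Blocks S len rs
  Blocks-map R⇒S B j = proj₁ (B j) , λ d d+1<a → R⇒S _ (proj₂ (B j) d d+1<a)

  Blocks-∷ : ∀ {R len m rs} → Block R 0 m → Blocks (λ u → R (m + u)) len rs → Blocks R (m + len) (m ∷ rs)
  Blocks-∷ {len = len} {m} first rest zero    = m≤m+n m len , first
  Blocks-∷ {R} {len} {m} {rs} first rest (suc j) =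
    subst (_≤ m + len) (sym (+-assoc m o _)) (+-monoʳ-≤ m (proj₁ (rest j))) ,
    λ d d+1<a → subst R (sym (+-assoc m o d)) (proj₂ (rest j) d d+1<a)
    where
    o : ℕ
    o = sum (take (toℕ j) rs)

  Blocks-merge : ∀ {R len r₀ r₁ rs} → Blocks R len (r₀ ∷ r₁ ∷ rs) → (∀ d → suc d ≡ r₀ → R d) →
    Blocks R len (r₀ + r₁ ∷ rs)
  Blocks-merge {R} {len} {r₀} {r₁} B boundary zero =
    subst (λ o → o + r₁ ≤ len) (+-identityʳ r₀) (proj₁ (B (suc zero))) , merged
    where
    merged : Block R 0 (r₀ + r₁)
    merged d d+1<r₀+r₁ with <-cmp (suc d) r₀
    ... | tri< d+1<r₀ _ _ = proj₂ (B zero) d d+1<r₀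
    ... | tri≈ _ d+1≡r₀ _ = boundary d d+1≡r₀
    ... | tri> _ _ r₀<d+1 = subst R (trans (cong (_+ d′) (+-identityʳ r₀)) r₀+d′≡d)
                              (proj₂ (B (suc zero)) d′ d′+1<r₁)
      where
      d′ : ℕ
      d′ = d ∸ r₀
      r₀+d′≡d : r₀ + d′ ≡ d
      r₀+d′≡d = m+[n∸m]≡n (s≤s⁻¹ r₀<d+1)
      d′+1<r₁ : suc d′ < r₁
      d′+1<r₁ = +-cancelˡ-< r₀ (suc d′) r₁
        (subst (_< r₀ + r₁) (trans (cong suc (sym r₀+d′≡d)) (sym (+-suc r₀ d′))) d+1<r₀+r₁)
  Blocks-merge {R} {len} {r₀} {r₁} {rs} B boundary (suc j) =
    subst (λ o → o + lookup rs j ≤ len × Block R o (lookup rs j)) (sym (+-assoc r₀ r₁ _)) (B (suc (suc j)))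

  Steady : List Bool → ℕ → Set
  Steady xs u = entry xs u ≡ entry xs (suc u)

  entry-replicate-++ : ∀ m (c : Bool) ys {d} → d < m → entry (replicate m c ++ ys) d ≡ c
  entry-replicate-++ (suc m) c ys {zero}  _         = refl
  entry-replicate-++ (suc m) c ys {suc d} (s≤s d<m) = entry-replicate-++ m c ys d<m

  entry-replicate-++ʳ : ∀ m (c : Bool) ys u → entry (replicate m c ++ ys) (m + u) ≡ entry ys u
  entry-replicate-++ʳ zero    c ys u = refl
  entry-replicate-++ʳ (suc m) c ys u = entry-replicate-++ʳ m c ys u

  replicate-++-∷ : ∀ m (c : Bool) ys → replicate m c ++ c ∷ ys ≡ replicate (suc m) c ++ ys
  replicate-++-∷ zero    c ys = refl
  replicate-++-∷ (suc m) c ys = cong (c ∷_) (replicate-++-∷ m c ys)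

  eqBool-≡ : ∀ {x y} → eqBool x y ≡ true → x ≡ y
  eqBool-≡ {true}  {true}  _ = refl
  eqBool-≡ {false} {false} _ = refl

  replicate-steady : ∀ m (c : Bool) ys → Block (Steady (replicate m c ++ ys)) 0 m
  replicate-steady m c ys d d+1<m =
    trans (entry-replicate-++ m c ys (<-trans (n<1+n d) d+1<m)) (sym (entry-replicate-++ m c ys d+1<m))

  runsFrom-blocks : ∀ c m ys → Blocks (Steady (replicate m c ++ ys)) (m + length ys) (runsFrom c m ys)
  runsFrom-blocks c m [] = Blocks-∷ (replicate-steady m c []) (λ ())
  runsFrom-blocks c m (y ∷ ys) with eqBool y c in y≈c
  ... | true rewrite eqBool-≡ y≈c =
    subst₂ (λ xs len → Blocks (Steady xs) len (runsFrom c (suc m) ys))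
      (sym (replicate-++-∷ m c ys)) (sym (+-suc m (length ys))) (runsFrom-blocks c (suc m) ys)
  ... | false = Blocks-∷ (replicate-steady m c (y ∷ ys)) (Blocks-map shift (runsFrom-blocks y 1 ys))
    where
    shift : ∀ u → Steady (y ∷ ys) u → Steady (replicate m c ++ y ∷ ys) (m + u)
    shift u steady = begin
      entry (replicate m c ++ y ∷ ys) (m + u)      ≡⟨ entry-replicate-++ʳ m c (y ∷ ys) u ⟩
      entry (y ∷ ys) u                             ≡⟨ steady ⟩
      entry (y ∷ ys) (suc u)                       ≡⟨ entry-replicate-++ʳ m c (y ∷ ys) (suc u) ⟨
      entry (replicate m c ++ y ∷ ys) (m + suc u)  ≡⟨ cong (entry (replicate m c ++ y ∷ ys)) (+-suc m u) ⟩
      entry (replicate m c ++ y ∷ ys) (suc (m + u)) ∎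
      where open ≡-Reasoning

  runs-blocks : ∀ xs → Blocks (Steady xs) (length xs) (runs xs)
  runs-blocks []       = λ ()
  runs-blocks (x ∷ xs) = runsFrom-blocks x 1 xs

  steady-prefix : ∀ {xs a} → Block (Steady xs) 0 a → ∀ d → d < a → entry xs d ≡ entry xs 0
  steady-prefix B zero    _     = refl
  steady-prefix {xs} B (suc d) d+1<a = trans (sym (B d d+1<a)) (steady-prefix {xs} B d (<-trans (n<1+n d) d+1<a))

  first-run-≤ : ∀ {xs len r₀ rs} u → entry xs u ≢ entry xs 0 → Blocks (Steady xs) len (r₀ ∷ rs) → r₀ ≤ u
  first-run-≤ {xs} u differs B = ≮⇒≥ (λ u<r₀ → differs (steady-prefix {xs} (proj₂ (B zero)) u u<r₀))

  shortSeq-blocks : ∀ k {n} (b : Vec Bool n) → 2 ≤ k → entry (toList b) 0 ≡ false →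
    Blocks (Exchangeable k b) n (shortSeq k b)
  shortSeq-blocks k b 2≤k b₁≡0 =
    subst (λ len → Blocks (Exchangeable k b) len (shortSeq k b)) (length-toList b) blocks
    where
    xs : List Bool
    xs = toList b
    steady-exchangeable : ∀ u → Steady xs u → Exchangeable k b u
    steady-exchangeable _ = inj₁
    blocks : Blocks (Exchangeable k b) (length xs) (shortSeq k b)
    blocks with entry xs (k ∸ 1) in b_k
    ... | false = Blocks-map steady-exchangeable (runs-blocks xs)
    ... | true  = merged (runs xs) (runs-blocks xs)
      where
      b_k≢b₁ : entry xs (k ∸ 1) ≢ entry xs 0
      b_k≢b₁ eq = contradiction (trans (sym b_k) (trans eq b₁≡0)) λ ()
      first-run<k : ∀ {r₀ rs} → Blocks (Steady xs) (length xs) (r₀ ∷ rs) → r₀ < k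
      first-run<k B = subst (_ <_) (m+[n∸m]≡n (<⇒≤ 2≤k)) (s≤s (first-run-≤ {xs = xs} (k ∸ 1) b_k≢b₁ B))
      merged : ∀ rs → Blocks (Steady xs) (length xs) rs →
        Blocks (Exchangeable k b) (length xs) (mergeFirstTwo rs)
      merged []             _ = λ ()
      merged (_ ∷ [])       B = Blocks-map steady-exchangeable B
      merged (r₀ ∷ r₁ ∷ rs) B = Blocks-merge {R = Exchangeable k b} (Blocks-map steady-exchangeable B)
        λ d d+1≡r₀ → inj₂ (subst (_< k) (sym d+1≡r₀) (first-run<k B))

open import Defs
open import Data.Bool using (Bool; false)
open import Data.Nat using (ℕ; _≤_; _<_; _∸_; suc; _+_; z<s; s≤s)
open import Data.Fin using (Fin; toℕ; zero)
open import Data.List using (length; lookup; take)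
open import Data.Nat.ListAction using (sum)
open import Data.Vec using (Vec; []; _∷_; toList)
import Data.Vec as V
open import Data.Integer using (ℤ; +_; -_)
open import Data.Product using (_,_)
open import Relation.Binary.PropositionalEquality using (_≡_; refl; sym; cong; subst)

open TwinRuns using (TwinRun; run-eigenvalue)
open AdjacentTransposition using (Exchangeable; adj-sym; adj-diagonal; adjacent-twins)
open ShortSequenceBlocks using (Block; shortSeq-blocks)

first-entry-false : ∀ {k n} (b : Vec Bool n) → 2 ≤ k →
  (∀ (i : Fin n) → toℕ i < k ∸ 1 → V.lookup b i ≡ false) → entry (toList b) 0 ≡ false
first-entry-false []      _               _     = refl
first-entry-false (_ ∷ _) (s≤s (s≤s _)) zeros = zeros zero z<s

block-twin-run : ∀ k {n} (b : Vec Bool n) {o a} → Block (Exchangeable k b) o a →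
  TwinRun (λ x y → + adj k b x y) o a
block-twin-run k b steps d+1<a x≡o+d y≡x+1 i i≢x i≢y =
  cong +_ (adjacent-twins k b (subst (Exchangeable k b) (sym x≡o+d) (steps _ d+1<a)) y≡x+1 i i≢x i≢y)

theorem1 : (k n : ℕ) → 2 ≤ k → (b : Vec Bool n) →
    (∀ (i : Fin n) → toℕ i < k ∸ 1 → V.lookup b i ≡ false) →
    (j : Fin (length (shortSeq k b))) →
    2 ≤ lookup (shortSeq k b) j →
    (p q : Fin n) →
    toℕ p ≡ sum (take (toℕ j) (shortSeq k b)) →
    toℕ q ≡ suc (toℕ p) →
    EigenvalueMultAtLeast (λ x y → + adj k b x y) (- (+ adj k b p q))
      (lookup (shortSeq k b) j ∸ 1)
theorem1 k n 2≤k b zeros j _ p q p≡start q≡p+1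
  with shortSeq-blocks k b 2≤k (first-entry-false b 2≤k zeros) j
... | start+a≤n , steps =
  run-eigenvalue A-sym A-diagonal p q (lookup (shortSeq k b) j)
    (subst (λ o → o + _ ≤ n) (sym p≡start) start+a≤n) q≡p+1
    (subst (λ o → TwinRun A o _) (sym p≡start) (block-twin-run k b steps))
  where
  A : Fin n → Fin n → ℤ
  A x y = + adj k b x y
  A-sym : ∀ x y → A x y ≡ A y x
  A-sym x y = cong +_ (adj-sym k b x y)
  A-diagonal : ∀ x → A x x ≡ + 0
  A-diagonal x = cong +_ (adj-diagonal k b x)
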